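{- Let $f \colon X \to Y$ be a map between orthosets. The following are equivalent: (a) $f$ is an orthoisomorphism; (b) $f$ is bijective and $f^{ -1}$ is an adjoint of $f$; (c) $f$ is bijective and possesses an adjoint $g \colon Y \to X$ such that $g \circ f \parallel \mathrm{id}_X$; (d) $f$ is bijective and adjointable, and $g \circ f \parallel \mathrm{id}_X$ for every adjoint $g$ of $f$.
   Context: An orthoset (with $0$) is a non-empty set $X$ with a binary relation $\perp$ and element $0$ such that: $\perp$ is symmetric; $x\perp x$ iff $x=0$; $0\perp x$ for all $x$. Elements $x,y$ are equivalent, $x\parallel y$, if $\{x\}^\perp=\{y\}^\perp$, where $\{x\}^\perp=\{z:z\perp x\}$. For maps $h,h'\colon X\to Y$, $h\parallel h'$ means $h(x)\parallel h'(x)$ for all $x\in X$. A map $g\colon Y\to X$ is an adjoint of $f\colon X\to Y$ if $f(x)\perp y\iff x\perp g(y)$ for all $x,y$; $f$ is adjointable if it has an adjoint. An orthoisomorphism is a bijection $f$ with $f(0)=0$ such that $x\perp y\iff f(x)\perp f(y)$ for all $x,y$. -}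

module Defs where

open import Level using (Level; suc; _⊔_)
open import Relation.Binary.PropositionalEquality using (_≡_)
open import Relation.Nullary using (¬_)
open import Data.Product using (Σ; _×_; _,_; ∃)
open import Function.Base using (_∘_; id)
open import Function.Definitions using (Bijective; Inverseˡ; Inverseʳ)

record Orthoset (a ℓ : Level) : Set (suc (a ⊔ ℓ)) where
  field
    Carrier : Set a
    _⊥_     : Carrier → Carrier → Set ℓ
    𝟎       : Carrier
    ⊥-sym   : ∀ {x y} → x ⊥ y → y ⊥ x
    ⊥-self⇒0 : ∀ {x} → x ⊥ x → x ≡ 𝟎
    0⊥      : ∀ x → 𝟎 ⊥ x

module _ {a b ℓ ℓ′ : Level} (X : Orthoset a ℓ) (Y : Orthoset b ℓ′) where
  private
    module X = Orthoset X
    module Y = Orthoset Y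

  IsAdjoint : (X.Carrier → Y.Carrier) → (Y.Carrier → X.Carrier) → Set (a ⊔ b ⊔ ℓ ⊔ ℓ′)
  IsAdjoint f g = ∀ x y → (Y._⊥_ (f x) y → X._⊥_ x (g y)) × (X._⊥_ x (g y) → Y._⊥_ (f x) y)

  Adjointable : (X.Carrier → Y.Carrier) → Set (a ⊔ b ⊔ ℓ ⊔ ℓ′)
  Adjointable f = Σ (Y.Carrier → X.Carrier) (IsAdjoint f)

  IsOrthoisomorphism : (X.Carrier → Y.Carrier) → Set (a ⊔ b ⊔ ℓ ⊔ ℓ′)
  IsOrthoisomorphism f =
    Bijective _≡_ _≡_ f × (f X.𝟎 ≡ Y.𝟎) ×
    (∀ x y → (X._⊥_ x y → Y._⊥_ (f x) (f y)) × (Y._⊥_ (f x) (f y) → X._⊥_ x y))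

-- x ∥ y : {x}^⊥ = {y}^⊥, i.e. ∀ z, z ⊥ x ⇔ z ⊥ y
module _ {a ℓ : Level} (X : Orthoset a ℓ) where
  private module X = Orthoset X

  _∥_ : X.Carrier → X.Carrier → Set (a ⊔ ℓ)
  x ∥ y = ∀ z → (X._⊥_ z x → X._⊥_ z y) × (X._⊥_ z y → X._⊥_ z x)

  _∥ₘ_ : {c : Level} {W : Set c} → (W → X.Carrier) → (W → X.Carrier) → Set (a ⊔ ℓ ⊔ c)
  h ∥ₘ h′ = ∀ w → h w ∥ h′ w

IsInverse : {a b : Level} {A : Set a} {B : Set b} → (A → B) → (B → A) → Set (a ⊔ b)
IsInverse f g = (∀ x → g (f x) ≡ x) × (∀ y → f (g y) ≡ y)

{-# OPTIONS --safe #-}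
module Submission where

-- For an adjoint g of f, the adjunction turns  z ⊥ g (f w)  into  f z ⊥ f w.  Hence
-- g ∘ f ∥ id says exactly that f preserves and reflects orthogonality, and a bijection
-- doing so is an orthoisomorphism (0 is the only self-orthogonal element, so f 0 = 0)
-- whose inverse is an adjoint.  All four conditions thus reduce to "f is bijective and
-- preserves and reflects ⊥".

open import Defs
open import Level using (Level; _⊔_)
open import Data.Product using (Σ; _×_; _,_; proj₁; proj₂)
open import Function.Base using (_∘_; id)
open import Function.Bundles using (_⇔_; mk⇔; mk⤖; Inverse; Equivalence)
open import Function.Definitions using (Bijective)
open import Function.Properties.Bijection using (⤖⇒↔)
open import Relation.Binary.PropositionalEquality using (_≡_; sym; subst)

bijective⇒inverse : ∀ {a b} {A : Set a} {B : Set b} {f : A → B} →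
                    Bijective _≡_ _≡_ f → Σ (B → A) (IsInverse f)
bijective⇒inverse bij = from , strictlyInverseʳ , strictlyInverseˡ
  where open Inverse (⤖⇒↔ (mk⤖ bij))

module _ {a ℓ : Level} (X : Orthoset a ℓ) where
  open Orthoset X

  ∥ₘ-reflexive : ∀ {c} {W : Set c} {h h′ : W → Carrier} →
                 (∀ w → h w ≡ h′ w) → _∥ₘ_ X h h′
  ∥ₘ-reflexive h≡h′ w z = subst (z ⊥_) (h≡h′ w) , subst (z ⊥_) (sym (h≡h′ w))

module _ {a b ℓ ℓ′ : Level} (X : Orthoset a ℓ) (Y : Orthoset b ℓ′) where
  private
    module X = Orthoset X
    module Y = Orthoset Y

  PreservesAndReflects⊥ : (X.Carrier → Y.Carrier) → Set (a ⊔ ℓ ⊔ ℓ′)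
  PreservesAndReflects⊥ f = ∀ x y → (x X.⊥ y → f x Y.⊥ f y) × (f x Y.⊥ f y → x X.⊥ y)

  module _ {f : X.Carrier → Y.Carrier} where

    preservesAndReflects⊥⇒𝟎↦𝟎 : PreservesAndReflects⊥ f → f X.𝟎 ≡ Y.𝟎
    preservesAndReflects⊥⇒𝟎↦𝟎 pr = Y.⊥-self⇒0 (proj₁ (pr X.𝟎 X.𝟎) (X.0⊥ X.𝟎))

    bijective∧preservesAndReflects⊥⇒orthoiso : Bijective _≡_ _≡_ f →
      PreservesAndReflects⊥ f → IsOrthoisomorphism X Y f
    bijective∧preservesAndReflects⊥⇒orthoiso bij pr = bij , preservesAndReflects⊥⇒𝟎↦𝟎 pr , pr

    adjoint∘∥id⇔preservesAndReflects⊥ : {g : Y.Carrier → X.Carrier} → IsAdjoint X Y f g →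
      _∥ₘ_ X (g ∘ f) id ⇔ PreservesAndReflects⊥ f
    adjoint∘∥id⇔preservesAndReflects⊥ {g} adj = mk⇔ to from
      where
      to : _∥ₘ_ X (g ∘ f) id → PreservesAndReflects⊥ f
      to gf∥id x y = (λ x⊥y → proj₂ (adj x (f y)) (proj₂ (gf∥id y x) x⊥y))
                   , (λ fx⊥fy → proj₁ (gf∥id y x) (proj₁ (adj x (f y)) fx⊥fy))

      from : PreservesAndReflects⊥ f → _∥ₘ_ X (g ∘ f) id
      from pr w z = (λ z⊥gfw → proj₂ (pr z w) (proj₂ (adj z (f w)) z⊥gfw))
                  , (λ z⊥w → proj₁ (adj z (f w)) (proj₁ (pr z w) z⊥w))

    rightInverse-isAdjoint : {g : Y.Carrier → X.Carrier} → (∀ y → f (g y) ≡ y) →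
      PreservesAndReflects⊥ f → IsAdjoint X Y f g
    rightInverse-isAdjoint {g} fg≡id pr x y =
        (λ fx⊥y → proj₂ (pr x (g y)) (subst (f x Y.⊥_) (sym (fg≡id y)) fx⊥y))
      , (λ x⊥gy → subst (f x Y.⊥_) (fg≡id y) (proj₁ (pr x (g y)) x⊥gy))

    orthoiso⇒inverse-isAdjoint : IsOrthoisomorphism X Y f →
      Σ (Y.Carrier → X.Carrier) (λ g → IsInverse f g × IsAdjoint X Y f g)
    orthoiso⇒inverse-isAdjoint (bij , _ , pr) =
      let (g , gf≡id , fg≡id) = bijective⇒inverse bij in
      g , (gf≡id , fg≡id) , rightInverse-isAdjoint fg≡id pr

    orthoiso⇒adjoint∘∥id : IsOrthoisomorphism X Y f → {g : Y.Carrier → X.Carrier} →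
      IsAdjoint X Y f g → _∥ₘ_ X (g ∘ f) id
    orthoiso⇒adjoint∘∥id (_ , _ , pr) adj =
      Equivalence.from (adjoint∘∥id⇔preservesAndReflects⊥ adj) pr

    bijective∧adjoint∘∥id⇒orthoiso : Bijective _≡_ _≡_ f → {g : Y.Carrier → X.Carrier} →
      IsAdjoint X Y f g → _∥ₘ_ X (g ∘ f) id → IsOrthoisomorphism X Y f
    bijective∧adjoint∘∥id⇒orthoiso bij adj gf∥id =
      bijective∧preservesAndReflects⊥⇒orthoiso bij
        (Equivalence.to (adjoint∘∥id⇔preservesAndReflects⊥ adj) gf∥id)

proposition4p2 : {a b ℓ ℓ′ : Level} (X : Orthoset a ℓ) (Y : Orthoset b ℓ′)
    (f : Orthoset.Carrier X → Orthoset.Carrier Y) →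
    let
      A = IsOrthoisomorphism X Y f
      B = Bijective _≡_ _≡_ f × Σ (Orthoset.Carrier Y → Orthoset.Carrier X) (λ g → IsInverse f g × IsAdjoint X Y f g)
      C = Bijective _≡_ _≡_ f × Σ (Orthoset.Carrier Y → Orthoset.Carrier X) (λ g → IsAdjoint X Y f g × _∥ₘ_ X (g ∘ f) id)
      D = Bijective _≡_ _≡_ f × Adjointable X Y f × ((g : Orthoset.Carrier Y → Orthoset.Carrier X) → IsAdjoint X Y f g → _∥ₘ_ X (g ∘ f) id)
    in (A ⇔ B) × (A ⇔ C) × (A ⇔ D)
proposition4p2 X Y f =
    mk⇔ (λ iso → proj₁ iso , orthoiso⇒inverse-isAdjoint X Y iso)
        (λ (bij , g , (gf≡id , _) , adj) → bijective∧adjoint∘∥id⇒orthoiso X Y bij adj (∥ₘ-reflexive X gf≡id))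
  , mk⇔ (λ iso → let (g , _ , adj) = orthoiso⇒inverse-isAdjoint X Y iso in
                 proj₁ iso , g , adj , orthoiso⇒adjoint∘∥id X Y iso adj)
        (λ (bij , g , adj , gf∥id) → bijective∧adjoint∘∥id⇒orthoiso X Y bij adj gf∥id)
  , mk⇔ (λ iso → let (g , _ , adj) = orthoiso⇒inverse-isAdjoint X Y iso in
                 proj₁ iso , (g , adj) , λ _ → orthoiso⇒adjoint∘∥id X Y iso)
        (λ (bij , (g , adj) , gf∥id) → bijective∧adjoint∘∥id⇒orthoiso X Y bij adj (gf∥id g adj))
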